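{- Let $G$ be a finite simple graph with maximum degree $d_{\max}(G)$. Then $\Delta(G)\ge d_{\max}(G)-1$.
   Context: For a finite simple graph $G$, the elements of $G$ are its vertices and edges. Two elements $\alpha,\beta\in V(G)\cup E(G)$ are incident if $\alpha=\beta$, or one is an edge and the other is an endpoint of that edge. $M(G)$ is the $0/1$ matrix with rows and columns indexed by $V(G)\cup E(G)$ whose $(\alpha,\beta)$ entry is $1$ iff $\alpha$ and $\beta$ are incident; equivalently $M(G)=\begin{bmatrix} I & B\\ B^\intercal & I\end{bmatrix}$ where $B$ is the vertex-edge incidence matrix of $G$. $\Delta(G)$ denotes the maximum of $|\det M'|$ over all square submatrices $M'$ of $M(G)$. -}

module Defs where

open import Data.Nat using (ℕ; zero; suc; _⊔_; _≤_)
open import Data.Fin using (Fin; zero; suc; punchIn; splitAt; _<_)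
open import Data.Fin.Properties using (_≟_)
open import Data.Integer using (ℤ; +_; -_; ∣_∣) renaming (_+_ to _+ℤ_; _*_ to _*ℤ_)
open import Data.Product using (_×_; _,_; Σ; ∃; ∃-syntax; proj₁; proj₂)
open import Data.Sum using (_⊎_; inj₁; inj₂)
open import Data.Bool using (Bool; true; false; _∨_; if_then_else_)
open import Data.List using (List; foldr; map)
open import Data.Nat.ListAction using (sum)
open import Data.List using () renaming (allFin to allFinL)
open import Relation.Binary.PropositionalEquality using (_≡_; _≢_)
open import Relation.Nullary using (¬_)
open import Relation.Nullary.Decidable using (⌊_⌋)

record Graph : Set where
  field
    n m   : ℕ
    ends  : Fin m → Fin n × Fin n
    noLoop : ∀ e → proj₁ (ends e) ≢ proj₂ (ends e)
    noMulti : ∀ e f →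
      ((proj₁ (ends e) ≡ proj₁ (ends f) × proj₂ (ends e) ≡ proj₂ (ends f)) ⊎
       (proj₁ (ends e) ≡ proj₂ (ends f) × proj₂ (ends e) ≡ proj₁ (ends f))) →
      e ≡ f

open Graph public

endpoint? : (G : Graph) → Fin (n G) → Fin (m G) → Bool
endpoint? G v e = ⌊ v ≟ proj₁ (ends G e) ⌋ ∨ ⌊ v ≟ proj₂ (ends G e) ⌋

degree : (G : Graph) → Fin (n G) → ℕ
degree G v = sum (map (λ e → if endpoint? G v e then 1 else 0) (allFinL (m G)))

-- maximum degree (0 for the empty graph)
dmax : (G : Graph) → ℕ
dmax G = foldr (λ v acc → degree G v ⊔ acc) 0 (allFinL (n G))

-- Elements of G: Fin (n + m), the first n being vertices, the rest edges.

Element : Graph → Set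
Element G = Fin (n G Data.Nat.+ m G)

incident? : (G : Graph) → Fin (n G) ⊎ Fin (m G) → Fin (n G) ⊎ Fin (m G) → Bool
incident? G (inj₁ u) (inj₁ v) = ⌊ u ≟ v ⌋
incident? G (inj₂ e) (inj₂ f) = ⌊ e ≟ f ⌋
incident? G (inj₁ v) (inj₂ e) = endpoint? G v e
incident? G (inj₂ e) (inj₁ v) = endpoint? G v e

-- the incidence matrix M(G) = [[I, B],[Bᵀ, I]] over ℤ
M : (G : Graph) → Element G → Element G → ℤ
M G α β = if incident? G (splitAt (n G) α) (splitAt (n G) β) then + 1 else + 0

Matrix : ℕ → Set
Matrix k = Fin k → Fin k → ℤ

sumFin : ∀ {k} → (Fin k → ℤ) → ℤ
sumFin {zero} f = + 0
sumFin {suc k} f = f zero +ℤ sumFin (λ i → f (suc i))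

sgn : ∀ {k} → Fin k → ℤ
sgn zero = + 1
sgn (suc j) = - sgn j

det : ∀ {k} → Matrix k → ℤ
det {zero} A = + 1
det {suc k} A = sumFin (λ j → sgn j *ℤ (A zero j *ℤ det (λ r c → A (suc r) (punchIn j c))))

StrictlyIncreasing : ∀ {k N} → (Fin k → Fin N) → Set
StrictlyIncreasing f = ∀ i j → i < j → f i < f j

-- "Δ(G) ≥ c": Δ(G) is the maximum of |det M'| over the (finitely many)
-- square submatrices M' of M(G), so Δ(G) ≥ c iff some square submatrix
-- has |det| ≥ c.
Δ≥ : Graph → ℕ → Set
Δ≥ G c = ∃[ k ] Σ (Fin k → Element G) λ rows → Σ (Fin k → Element G) λ cols →
  StrictlyIncreasing rows × StrictlyIncreasing cols ×
  (c ≤ ∣ det (λ i j → M G (rows i) (cols j)) ∣)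

{-# OPTIONS --safe #-}
module Submission where

-- For a vertex v of degree d, the principal submatrix of M(G) on v and its d incident edges is
-- the arrow matrix [[1, 1ᵀ], [1, I_d]]: the edges are pairwise non-incident and all meet v.
-- Expanding along the first row gives det = 1 - d, so a vertex of maximum degree yields the bound.

open import Defs
open import Data.Nat using (ℕ; zero; suc; _⊔_; _≤_; _≤?_; _∸_; z≤n; s≤s)
open import Data.Nat.Properties
  using (≤-refl; ≤-reflexive; ≤-trans; <⇒≤; ≰⇒>; ⊔-lub; ⊔-identityʳ; m≤m+n; +-monoʳ-<; ∸-monoˡ-≤; module ≤-Reasoning)
open import Data.Nat.ListAction using (sum)
open import Data.Fin using (Fin; zero; suc; _<_; punchIn; _↑ˡ_; _↑ʳ_; join)
open import Data.Fin.Properties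
  using (suc-injective; toℕ-↑ˡ; toℕ-↑ʳ; toℕ<n; splitAt-join; <-cmp; <-irrefl; _≟_)
open import Data.Integer using (ℤ; +_; -_; _+_; _*_; _-_; ∣_∣; 0ℤ; 1ℤ; -1ℤ)
open import Data.Integer.Properties using (*-zeroʳ; +-identityʳ; *-identityˡ; *-distribʳ-+; -1*i≡-i)
open import Data.Integer.Tactic.RingSolver using (solve-∀)
open import Data.Bool using (Bool; true; false; if_then_else_)
open import Data.List using (List; []; _∷_; foldr; tabulate; allFin)
open import Data.List.Properties using (map-tabulate)
open import Data.Product using (_×_; _,_; proj₁; proj₂; ∃)
open import Data.Sum using (_⊎_; inj₁; inj₂)
open import Function using (id; _∘_)
open import Relation.Binary.Definitions using (tri<; tri≈; tri>)
open import Relation.Binary.PropositionalEquality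
open import Relation.Nullary using (Dec; ¬_; yes; no; contradiction)
open import Relation.Nullary.Decidable using (⌊_⌋; isYes≗does; dec-true; dec-false)

sumFin-const : ∀ {k} {f : Fin k → ℤ} c → (∀ i → f i ≡ c) → sumFin f ≡ + k * c
sumFin-const {zero} c _ = refl
sumFin-const {suc k} {f} c f≡c = begin
  f zero + sumFin (λ i → f (suc i)) ≡⟨ cong₂ _+_ (f≡c zero) (sumFin-const c (λ i → f≡c (suc i))) ⟩
  c + + k * c                       ≡⟨ cong (_+ + k * c) (sym (*-identityˡ c)) ⟩
  1ℤ * c + + k * c                  ≡⟨ *-distribʳ-+ c 1ℤ (+ k) ⟨
  + suc k * c                       ∎
  where open ≡-Reasoning

sumFin-zero : ∀ {k} {f : Fin k → ℤ} → (∀ i → f i ≡ 0ℤ) → sumFin f ≡ 0ℤ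
sumFin-zero {k} f≡0 = trans (sumFin-const 0ℤ f≡0) (*-zeroʳ (+ k))

sgn*sgn≡1 : ∀ {k} (j : Fin k) → sgn j * sgn j ≡ 1ℤ
sgn*sgn≡1 zero    = refl
sgn*sgn≡1 (suc j) = trans (neg*neg (sgn j)) (sgn*sgn≡1 j)
  where
  neg*neg : ∀ x → - x * - x ≡ x * x
  neg*neg = solve-∀

minor : ∀ {k} → Matrix (suc k) → Fin (suc k) → Matrix k
minor A j r c = A (suc r) (punchIn j c)

laplaceTerm : ∀ {k} → Matrix (suc k) → Fin (suc k) → ℤ
laplaceTerm A j = sgn j * (A zero j * det (minor A j))

laplaceTerm-entryZero : ∀ {k} (A : Matrix (suc k)) j → A zero j ≡ 0ℤ → laplaceTerm A j ≡ 0ℤ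
laplaceTerm-entryZero A j a≡0 = begin
  sgn j * (A zero j * det (minor A j)) ≡⟨ cong (λ a → sgn j * (a * det (minor A j))) a≡0 ⟩
  sgn j * 0ℤ                           ≡⟨ *-zeroʳ (sgn j) ⟩
  0ℤ                                   ∎
  where open ≡-Reasoning

laplaceTerm-minorZero : ∀ {k} (A : Matrix (suc k)) j → det (minor A j) ≡ 0ℤ → laplaceTerm A j ≡ 0ℤ
laplaceTerm-minorZero A j d≡0 = begin
  sgn j * (A zero j * det (minor A j)) ≡⟨ cong (λ d → sgn j * (A zero j * d)) d≡0 ⟩
  sgn j * (A zero j * 0ℤ)              ≡⟨ cong (sgn j *_) (*-zeroʳ (A zero j)) ⟩
  sgn j * 0ℤ                           ≡⟨ *-zeroʳ (sgn j) ⟩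
  0ℤ                                   ∎
  where open ≡-Reasoning

det-firstRowUnit : ∀ {k} (A : Matrix (suc k)) → (∀ j → A zero (suc j) ≡ 0ℤ) →
                   det A ≡ A zero zero * det (minor A zero)
det-firstRowUnit A row≡0 = begin
  laplaceTerm A zero + sumFin (λ j → laplaceTerm A (suc j))
    ≡⟨ cong₂ _+_ (*-identityˡ (A zero zero * det (minor A zero)))
                 (sumFin-zero (λ j → laplaceTerm-entryZero A (suc j) (row≡0 j))) ⟩
  A zero zero * det (minor A zero) + 0ℤ
    ≡⟨ +-identityʳ _ ⟩
  A zero zero * det (minor A zero) ∎
  where open ≡-Reasoning

det-zeroColumn : ∀ {k} (A : Matrix (suc k)) → (∀ i → A i zero ≡ 0ℤ) → det A ≡ 0ℤ
det-zeroColumn {zero}  A col≡0 = sumFin-zero {f = laplaceTerm A} λ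
  { zero → laplaceTerm-entryZero A zero (col≡0 zero)
  ; (suc ())
  }
det-zeroColumn {suc k} A col≡0 = sumFin-zero {f = laplaceTerm A} λ
  { zero    → laplaceTerm-entryZero A zero (col≡0 zero)
  ; (suc j) → laplaceTerm-minorZero A (suc j) (det-zeroColumn (minor A (suc j)) (λ i → col≡0 (suc i)))
  }

IsUnitVector : ∀ {k} → (Fin k → ℤ) → Fin k → Set
IsUnitVector v r = ∀ i → (i ≡ r → v i ≡ 1ℤ) × (i ≢ r → v i ≡ 0ℤ)

IsIdentity : ∀ {k} → Matrix k → Set
IsIdentity A = ∀ c → IsUnitVector (λ i → A i c) c

unitVector-tail : ∀ {k} {v : Fin (suc k) → ℤ} {r} →
                  IsUnitVector v (suc r) → IsUnitVector (λ i → v (suc i)) r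
unitVector-tail unit i = (λ i≡r → proj₁ (unit (suc i)) (cong suc i≡r))
                       , (λ i≢r → proj₂ (unit (suc i)) (λ eq → i≢r (suc-injective eq)))

isIdentity-minorZero : ∀ {k} {A : Matrix (suc k)} → IsIdentity A → IsIdentity (minor A zero)
isIdentity-minorZero isId c = unitVector-tail (isId (suc c))

det-identity : ∀ {k} (A : Matrix k) → IsIdentity A → det A ≡ 1ℤ
det-identity {zero}  A isId = refl
det-identity {suc k} A isId = begin
  det A                            ≡⟨ det-firstRowUnit A (λ j → proj₂ (isId (suc j) zero) λ ()) ⟩
  A zero zero * det (minor A zero) ≡⟨ cong₂ _*_ (proj₁ (isId zero zero) refl)
                                                (det-identity (minor A zero) (isIdentity-minorZero isId)) ⟩
  1ℤ                               ∎
  where open ≡-Reasoning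

-- The identity matrix with its column j replaced by ones and moved to the front;
-- moving it back takes j adjacent column swaps.
IsOnesFirst : ∀ {k} → Fin (suc k) → Matrix (suc k) → Set
IsOnesFirst j B = (∀ i → B i zero ≡ 1ℤ) × (∀ c → IsUnitVector (λ i → B i (suc c)) (punchIn j c))

det-onesFirst : ∀ {k} j (B : Matrix (suc k)) → IsOnesFirst j B → det B ≡ sgn j
det-onesFirst zero B (ones , units) = begin
  det B                            ≡⟨ det-firstRowUnit B (λ c → proj₂ (units c zero) λ ()) ⟩
  B zero zero * det (minor B zero) ≡⟨ cong₂ _*_ (ones zero)
                                                (det-identity (minor B zero) (λ c → unitVector-tail (units c))) ⟩
  1ℤ                               ∎
  where open ≡-Reasoning
-- Only columns 0 and 1 of the first row are nonzero; the minor at column 0 has a zero first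
-- column, and the minor at column 1 has the same shape for j.
det-onesFirst {suc k} (suc j) B (ones , units) = begin
  laplaceTerm B zero + (laplaceTerm B (suc zero) + sumFin (λ c → laplaceTerm B (suc (suc c))))
    ≡⟨ cong₂ _+_ term₀ (cong₂ _+_ term₁ laterTerms) ⟩
  0ℤ + (- sgn j + 0ℤ)
    ≡⟨ zero+x+zero (- sgn j) ⟩
  - sgn j ∎
  where
  open ≡-Reasoning
  term₀ : laplaceTerm B zero ≡ 0ℤ
  term₀ = laplaceTerm-minorZero B zero
            (det-zeroColumn (minor B zero) (λ i → proj₂ (units zero (suc i)) λ ()))
  minorOnesFirst : IsOnesFirst j (minor B (suc zero))
  minorOnesFirst = (λ i → ones (suc i)) , (λ c → unitVector-tail (units (suc c)))
  term₁ : laplaceTerm B (suc zero) ≡ - sgn j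
  term₁ = begin
    -1ℤ * (B zero (suc zero) * det (minor B (suc zero)))
      ≡⟨ cong₂ (λ b d → -1ℤ * (b * d)) (proj₁ (units zero zero) refl)
                                       (det-onesFirst j (minor B (suc zero)) minorOnesFirst) ⟩
    -1ℤ * (1ℤ * sgn j)
      ≡⟨ cong (-1ℤ *_) (*-identityˡ (sgn j)) ⟩
    -1ℤ * sgn j
      ≡⟨ -1*i≡-i (sgn j) ⟩
    - sgn j ∎
  laterTerms : sumFin (λ c → laplaceTerm B (suc (suc c))) ≡ 0ℤ
  laterTerms = sumFin-zero λ c → laplaceTerm-entryZero B (suc (suc c)) (proj₂ (units (suc c) zero) λ ())
  zero+x+zero : ∀ x → 0ℤ + (x + 0ℤ) ≡ x
  zero+x+zero = solve-∀

IsArrow : ∀ {k} → Matrix (suc k) → Set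
IsArrow A = A zero zero ≡ 1ℤ × (∀ j → A zero (suc j) ≡ 1ℤ) × (∀ i → A (suc i) zero ≡ 1ℤ)
          × IsIdentity (minor A zero)

laplaceTerm-arrow : ∀ {k} (A : Matrix (suc k)) → IsArrow A → ∀ j → laplaceTerm A (suc j) ≡ -1ℤ
laplaceTerm-arrow {suc k} A (_ , row , column , identity) j = begin
  - sgn j * (A zero (suc j) * det (minor A (suc j)))
    ≡⟨ cong₂ (λ a d → - sgn j * (a * d)) (row j) (det-onesFirst j (minor A (suc j)) onesFirst) ⟩
  - sgn j * (1ℤ * sgn j)
    ≡⟨ neg-square (sgn j) ⟩
  - (sgn j * sgn j)
    ≡⟨ cong -_ (sgn*sgn≡1 j) ⟩
  -1ℤ ∎
  where
  open ≡-Reasoning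
  onesFirst : IsOnesFirst j (minor A (suc j))
  onesFirst = column , λ c → identity (punchIn j c)
  neg-square : ∀ s → - s * (1ℤ * s) ≡ - (s * s)
  neg-square = solve-∀

det-arrow : ∀ {k} (A : Matrix (suc k)) → IsArrow A → det A ≡ 1ℤ - + k
det-arrow {k} A arrow@(corner , _ , _ , identity) = begin
  laplaceTerm A zero + sumFin (λ j → laplaceTerm A (suc j))
    ≡⟨ cong₂ _+_ cornerTerm (sumFin-const -1ℤ (laplaceTerm-arrow A arrow)) ⟩
  1ℤ + + k * -1ℤ
    ≡⟨ one-minus (+ k) ⟩
  1ℤ - + k ∎
  where
  open ≡-Reasoning
  cornerTerm : laplaceTerm A zero ≡ 1ℤ
  cornerTerm = cong₂ (λ a d → 1ℤ * (a * d)) corner (det-identity (minor A zero) identity)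
  one-minus : ∀ x → 1ℤ + x * -1ℤ ≡ 1ℤ - x
  one-minus = solve-∀

foldr-⊔-attained : ∀ {A : Set} (g : A → ℕ) (xs : List A) →
  foldr (λ x acc → g x ⊔ acc) 0 xs ≡ 0 ⊎ ∃ λ x → foldr (λ x acc → g x ⊔ acc) 0 xs ≤ g x
foldr-⊔-attained g [] = inj₁ refl
foldr-⊔-attained g (x ∷ xs) with foldr-⊔-attained g xs
... | inj₁ rest≡0 = inj₂ (x , ≤-reflexive (trans (cong (g x ⊔_) rest≡0) (⊔-identityʳ (g x))))
... | inj₂ (y , rest≤gy) with g x ≤? g y
...   | yes gx≤gy = inj₂ (y , ⊔-lub gx≤gy rest≤gy)
...   | no  gx≰gy = inj₂ (x , ⊔-lub ≤-refl (≤-trans rest≤gy (<⇒≤ (≰⇒> gx≰gy))))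

count : ∀ {m} → (Fin m → Bool) → ℕ
count p = sum (tabulate (λ e → if p e then 1 else 0))

enumerate : ∀ {m} (p : Fin m → Bool) → Fin (count p) → Fin m
enumerate {suc m} p with p zero
... | true  = λ { zero → zero ; (suc i) → suc (enumerate (p ∘ suc) i) }
... | false = suc ∘ enumerate (p ∘ suc)

enumerate-satisfies : ∀ {m} (p : Fin m → Bool) i → p (enumerate p i) ≡ true
enumerate-satisfies {suc m} p i with p zero in p0
enumerate-satisfies {suc m} p zero    | true  = p0
enumerate-satisfies {suc m} p (suc i) | true  = enumerate-satisfies (p ∘ suc) i
enumerate-satisfies {suc m} p i       | false = enumerate-satisfies (p ∘ suc) i

enumerate-strictlyIncreasing : ∀ {m} (p : Fin m → Bool) → StrictlyIncreasing (enumerate p)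
enumerate-strictlyIncreasing {suc m} p i j i<j with p zero
enumerate-strictlyIncreasing {suc m} p zero    (suc j) i<j       | true  = s≤s z≤n
enumerate-strictlyIncreasing {suc m} p (suc i) (suc j) (s≤s i<j) | true  =
  s≤s (enumerate-strictlyIncreasing (p ∘ suc) i j i<j)
enumerate-strictlyIncreasing {suc m} p i       j       i<j       | false =
  s≤s (enumerate-strictlyIncreasing (p ∘ suc) i j i<j)

strictlyIncreasing⇒injective : ∀ {k N} {f : Fin k → Fin N} → StrictlyIncreasing f →
                               ∀ {i j} → f i ≡ f j → i ≡ j
strictlyIncreasing⇒injective inc {i} {j} fi≡fj with <-cmp i j
... | tri< i<j _ _ = contradiction (inc i j i<j) (<-irrefl fi≡fj)
... | tri≈ _ i≡j _ = i≡j
... | tri> _ _ j<i = contradiction (inc j i j<i) (<-irrefl (sym fi≡fj))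

↑ˡ<↑ʳ : ∀ {n m} (i : Fin n) (j : Fin m) → i ↑ˡ m < n ↑ʳ j
↑ˡ<↑ʳ {n} {m} i j rewrite toℕ-↑ˡ i m | toℕ-↑ʳ n j = ≤-trans (toℕ<n i) (m≤m+n n _)

↑ʳ-mono-< : ∀ n {m} {i j : Fin m} → i < j → n ↑ʳ i < n ↑ʳ j
↑ʳ-mono-< n {i = i} {j} i<j rewrite toℕ-↑ʳ n i | toℕ-↑ʳ n j = +-monoʳ-< n i<j

⌊⌋-true : ∀ {A : Set} (a? : Dec A) → A → ⌊ a? ⌋ ≡ true
⌊⌋-true a? a = trans (isYes≗does a?) (dec-true a? a)

⌊⌋-false : ∀ {A : Set} (a? : Dec A) → ¬ A → ⌊ a? ⌋ ≡ false
⌊⌋-false a? ¬a = trans (isYes≗does a?) (dec-false a? ¬a)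

M-join : ∀ G (α β : Fin (n G) ⊎ Fin (m G)) →
         M G (join (n G) (m G) α) (join (n G) (m G) β) ≡ (if incident? G α β then 1ℤ else 0ℤ)
M-join G α β = cong₂ (λ x y → if incident? G x y then 1ℤ else 0ℤ)
                     (splitAt-join (n G) (m G) α) (splitAt-join (n G) (m G) β)

degree≡count : ∀ G v → degree G v ≡ count (endpoint? G v)
degree≡count G v = cong sum (map-tabulate id (λ e → if endpoint? G v e then 1 else 0))

module Star (G : Graph) (v : Fin (n G)) where

  d : ℕ
  d = count (endpoint? G v)

  edge : Fin d → Fin (m G)
  edge = enumerate (endpoint? G v)

  star : Fin (suc d) → Fin (n G) ⊎ Fin (m G)
  star zero    = inj₁ v
  star (suc i) = inj₂ (edge i)

  element : Fin (suc d) → Element G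
  element = join (n G) (m G) ∘ star

  element-strictlyIncreasing : StrictlyIncreasing element
  element-strictlyIncreasing zero    (suc j) _         = ↑ˡ<↑ʳ v (edge j)
  element-strictlyIncreasing (suc i) (suc j) (s≤s i<j) =
    ↑ʳ-mono-< (n G) (enumerate-strictlyIncreasing (endpoint? G v) i j i<j)

  matrix : Matrix (suc d)
  matrix i j = M G (element i) (element j)

  entry-true : ∀ i j → incident? G (star i) (star j) ≡ true → matrix i j ≡ 1ℤ
  entry-true i j eq = trans (M-join G (star i) (star j)) (cong (λ b → if b then 1ℤ else 0ℤ) eq)

  entry-false : ∀ i j → incident? G (star i) (star j) ≡ false → matrix i j ≡ 0ℤ
  entry-false i j eq = trans (M-join G (star i) (star j)) (cong (λ b → if b then 1ℤ else 0ℤ) eq)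

  edge-injective : ∀ {i j} → edge i ≡ edge j → i ≡ j
  edge-injective = strictlyIncreasing⇒injective (enumerate-strictlyIncreasing (endpoint? G v))

  matrix-isArrow : IsArrow matrix
  matrix-isArrow = entry-true zero zero (⌊⌋-true (v ≟ v) refl)
                 , (λ j → entry-true zero (suc j) (enumerate-satisfies (endpoint? G v) j))
                 , (λ i → entry-true (suc i) zero (enumerate-satisfies (endpoint? G v) i))
                 , λ c i → (λ i≡c → entry-true (suc i) (suc c) (⌊⌋-true (edge i ≟ edge c) (cong edge i≡c)))
                         , (λ i≢c → entry-false (suc i) (suc c) (⌊⌋-false (edge i ≟ edge c) (i≢c ∘ edge-injective)))

pred≤∣1-n∣ : ∀ d → d ∸ 1 ≤ ∣ 1ℤ - + d ∣
pred≤∣1-n∣ zero          = z≤n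
pred≤∣1-n∣ (suc zero)    = z≤n
pred≤∣1-n∣ (suc (suc d)) = ≤-refl

Δ≥-mono : ∀ {G c c′} → c ≤ c′ → Δ≥ G c′ → Δ≥ G c
Δ≥-mono c≤c′ (k , rows , cols , rows↑ , cols↑ , c′≤det) =
  k , rows , cols , rows↑ , cols↑ , ≤-trans c≤c′ c′≤det

Δ≥-degree : ∀ G v → Δ≥ G (degree G v ∸ 1)
Δ≥-degree G v =
  suc d , element , element , element-strictlyIncreasing , element-strictlyIncreasing , bound
  where
  open Star G v
  open ≤-Reasoning
  bound : degree G v ∸ 1 ≤ ∣ det matrix ∣
  bound = begin
    degree G v ∸ 1     ≡⟨ cong (_∸ 1) (degree≡count G v) ⟩
    d ∸ 1              ≤⟨ pred≤∣1-n∣ d ⟩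
    ∣ 1ℤ - + d ∣       ≡⟨ cong ∣_∣ (det-arrow matrix matrix-isArrow) ⟨
    ∣ det matrix ∣     ∎

lemma2 : (G : Graph) → Δ≥ G (dmax G ∸ 1)
lemma2 G with foldr-⊔-attained (degree G) (allFin (n G))
... | inj₁ dmax≡0 = zero , (λ ()) , (λ ()) , (λ ()) , (λ ()) , subst (λ x → x ∸ 1 ≤ 1) (sym dmax≡0) z≤n
... | inj₂ (v , dmax≤degree) = Δ≥-mono {G} (∸-monoˡ-≤ 1 dmax≤degree) (Δ≥-degree G v)
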